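{- Let $\Sigma$ be a totally ordered alphabet, let $\$\notin\Sigma$ be a symbol smaller than every symbol of $\Sigma$, and let $T=T[0]\cdots T[n-1]$ be a string with $T[0,n-2]\in\Sigma^+$ and $T[n-1]=\$$. For $0\le k\le n-1$ write $T_k=T[k,n-1]$. Fix $s$ with $0\le s\le n-3$, and index the suffixes $T_{s+1},\dots,T_{n-1}$ by the positions $s+1,\dots,n-1$ in increasing lexicographic order: the position of $T_k$ is $s+1$ plus the number of suffixes in $\{T_{s+1},\dots,T_{n-1}\}$ lexicographically smaller than $T_k$. Let $p$ be the position of $T_{s+1}$. Let $r=s+|\{k\in\{s+1,\dots,n-1\}: T_k<T_s\}|$, so that $r$ is the position that $T_s$ occupies in the lexicographic order of $T_s,T_{s+1},\dots,T_{n-1}$ when these are indexed by the positions $s,s+1,\dots,n-1$. Let $T_a$, with $a\in\{s+1,\dots,n-1\}$, be the suffix whose position is $r$ (in the indexing of $T_{s+1},\dots,T_{n-1}$ by positions $s+1,\dots,n-1$). Suppose $a\le n-2$, and let $p_{a+1}$ be the position of $T_{a+1}$ in that same indexing. If $p_{a+1}\notin[s+1,p)$, then $T[a]\neq T[s]$.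
   Context: The array $B$ with $B[\text{position of }T_k]=T[k-1]$ for $s+2\le k\le n-1$ and $B[p]=\$$ is the Burrows–Wheeler transform of $T_{s+1}$ stored in positions $s+1,\dots,n-1$; in particular the symbol stored at position $p_{a+1}$ is $T[a]$, so the conclusion says that this stored symbol differs from $T[s]$. Lexicographic order $<$ on strings is the one induced by the order of $\Sigma\cup\{\$\}$. -}

module Defs where

open import Level using (Level; 0ℓ)
open import Data.Nat using (ℕ; zero; suc; _+_; _∸_; _≤_; _<_)
open import Data.List using (List; []; _∷_; _++_; [_]; map; drop; length; filter; upTo; head)
open import Data.Maybe using (Maybe)
open import Data.Empty using (⊥)
open import Relation.Nullary using (Dec; yes; no)
open import Relation.Binary.Core using (Rel)
open import Relation.Binary.Definitions using (Decidable; tri<; tri≈; tri>)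
open import Relation.Binary.Structures using (IsStrictTotalOrder)
open import Relation.Binary.PropositionalEquality using (_≡_; refl; cong)
import Data.List.Relation.Binary.Lex.Strict as LexS

data Sym (A : Set) : Set where
  $   : Sym A
  chr : A → Sym A

data SymLt {A : Set} (_<ₐ_ : Rel A 0ℓ) : Sym A → Sym A → Set where
  $<chr   : ∀ {x} → SymLt _<ₐ_ $ (chr x)
  chr<chr : ∀ {x y} → x <ₐ y → SymLt _<ₐ_ (chr x) (chr y)

module Suffixes {A : Set} {_<ₐ_ : Rel A 0ℓ}
                (isSTO : IsStrictTotalOrder _≡_ _<ₐ_) where

  open IsStrictTotalOrder isSTO using (compare)

  chr-inj : ∀ {x y} → chr {A} x ≡ chr y → x ≡ y
  chr-inj refl = refl

  _≟ₛ_ : Decidable {A = Sym A} _≡_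
  $ ≟ₛ $ = yes refl
  $ ≟ₛ chr y = no (λ ())
  chr x ≟ₛ $ = no (λ ())
  chr x ≟ₛ chr y with compare x y
  ... | tri< _ x≢y _ = no (λ e → x≢y (chr-inj e))
  ... | tri≈ _ x≡y _ = yes (cong chr x≡y)
  ... | tri> _ x≢y _ = no (λ e → x≢y (chr-inj e))

  _<ₛ?_ : Decidable (SymLt _<ₐ_)
  $ <ₛ? $ = no (λ ())
  $ <ₛ? chr y = yes $<chr
  chr x <ₛ? $ = no (λ ())
  chr x <ₛ? chr y with compare x y
  ... | tri< x<y _ _ = yes (chr<chr x<y)
  ... | tri≈ x≮y _ _ = no (λ { (chr<chr p) → x≮y p })
  ... | tri> x≮y _ _ = no (λ { (chr<chr p) → x≮y p })

  _<ₗ_ : Rel (List (Sym A)) 0ℓ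
  _<ₗ_ = LexS.Lex-< _≡_ (SymLt _<ₐ_)

  _<ₗ?_ : Decidable _<ₗ_
  _<ₗ?_ = LexS.<-decidable _≟ₛ_ _<ₛ?_

  -- The text T = w $, where w ∈ Σ⁺ (non-emptiness is a hypothesis of the theorem).
  text : List A → List (Sym A)
  text w = map chr w ++ [ $ ]

  suf : List (Sym A) → ℕ → List (Sym A)
  suf T k = drop k T

  at : List (Sym A) → ℕ → Maybe (Sym A)
  at T i = head (drop i T)

  range : ℕ → ℕ → List ℕ
  range lo hi = map (lo +_) (upTo (hi ∸ lo))

  countBelow : List (Sym A) → ℕ → List (Sym A) → ℕ
  countBelow T s X =
    length (filter (λ k → suf T k <ₗ? X) (range (suc s) (length T)))

  pos : List (Sym A) → ℕ → ℕ → ℕ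
  pos T s k = suc s + countBelow T s (suf T k)

  rank : List (Sym A) → ℕ → ℕ
  rank T s = s + countBelow T s (suf T s)

-- If T_a is the suffix ranked immediately below T_s and T[a] = T[s], then stripping the
-- common first symbol preserves the order, so T_{a+1} < T_{s+1}.  Since a + 1 lies in
-- {s+1, …, n-1}, T_{a+1} is counted among the suffixes below T_{s+1}, which forces the
-- position of T_{a+1} into [s+1, p).
module Submission where

open import Defs
open import Level using (Level; 0ℓ)
open import Data.Nat using (ℕ; suc; zero; _+_; _∸_; _≤_; _<_; s≤s; z≤n)
open import Data.Nat.Properties
open import Data.List using (List; length; []; _∷_; filter; drop; head)
open import Data.List.Relation.Unary.Any using (Any; here; there)
import Data.List.Relation.Unary.Any as Any
open import Data.List.Relation.Unary.Any.Properties using (map⁺)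
open import Data.List.Membership.Propositional.Properties using (∈-upTo⁺)
open import Data.List.Relation.Binary.Pointwise using (Pointwise-≡⇒≡; ≡⇒Pointwise-≡)
import Data.List.Relation.Binary.Lex.Strict as LexS
open import Data.List.Relation.Binary.Lex.Core using (this; next)
open import Data.Maybe.Properties using (just-injective)
open import Data.Product using (_×_; _,_; ∃)
open import Relation.Nullary using (¬_; yes; no; contradiction)
open import Relation.Unary using (Pred; Decidable; _⊆_)
open import Relation.Binary.Core using (Rel)
open import Relation.Binary.Definitions using (tri<; tri≈; tri>; Trichotomous)
open import Relation.Binary.Structures using (IsStrictTotalOrder)
open import Relation.Binary.PropositionalEquality

module _ {B : Set} {p q : Level} {P : Pred B p} {Q : Pred B q} (P? : Decidable P) (Q? : Decidable Q) (P⊆Q : P ⊆ Q) where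

  length-filter-mono : ∀ xs → length (filter P? xs) ≤ length (filter Q? xs)
  length-filter-mono [] = z≤n
  length-filter-mono (x ∷ xs) with P? x | Q? x
  ... | yes _  | yes _  = s≤s (length-filter-mono xs)
  ... | yes px | no ¬qx = contradiction (P⊆Q px) ¬qx
  ... | no _   | yes _  = m≤n⇒m≤1+n (length-filter-mono xs)
  ... | no _   | no _   = length-filter-mono xs

  length-filter-mono-< : ∀ xs → Any (λ x → Q x × ¬ P x) xs →
                         length (filter P? xs) < length (filter Q? xs)
  length-filter-mono-< (x ∷ xs) (here (qx , ¬px)) with P? x | Q? x
  ... | yes px | _      = contradiction px ¬px
  ... | no _   | yes _  = s≤s (length-filter-mono xs)
  ... | no _   | no ¬qx = contradiction qx ¬qx
  length-filter-mono-< (x ∷ xs) (there any) with P? x | Q? x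
  ... | yes _  | yes _  = s≤s (length-filter-mono-< xs any)
  ... | yes px | no ¬qx = contradiction (P⊆Q px) ¬qx
  ... | no _   | yes _  = m≤n⇒m≤1+n (length-filter-mono-< xs any)
  ... | no _   | no _   = length-filter-mono-< xs any

drop-∷ : {B : Set} (xs : List B) (i : ℕ) → i < length xs →
         ∃ λ y → drop i xs ≡ y ∷ drop (suc i) xs
drop-∷ (x ∷ xs) zero    _       = x , refl
drop-∷ (x ∷ xs) (suc i) (s≤s p) = drop-∷ xs i p

module SuffixOrder {A : Set} {_<ₐ_ : Rel A 0ℓ} (isSTO : IsStrictTotalOrder _≡_ _<ₐ_) where
  open Suffixes isSTO
  open IsStrictTotalOrder isSTO using (compare) renaming (trans to <ₐ-trans; irrefl to <ₐ-irrefl)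

  _<ₛ_ : Rel (Sym A) 0ℓ
  _<ₛ_ = SymLt _<ₐ_

  <ₛ-trans : ∀ {x y z} → x <ₛ y → y <ₛ z → x <ₛ z
  <ₛ-trans $<chr       (chr<chr _) = $<chr
  <ₛ-trans (chr<chr p) (chr<chr q) = chr<chr (<ₐ-trans p q)

  <ₛ-irrefl : ∀ {x y} → x ≡ y → ¬ x <ₛ y
  <ₛ-irrefl refl (chr<chr p) = <ₐ-irrefl refl p

  <ₛ-compare : Trichotomous _≡_ _<ₛ_
  <ₛ-compare $       $       = tri≈ (λ ()) refl (λ ())
  <ₛ-compare $       (chr y) = tri< $<chr (λ ()) (λ ())
  <ₛ-compare (chr x) $       = tri> (λ ()) (λ ()) $<chr
  <ₛ-compare (chr x) (chr y) with compare x y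
  ... | tri< a b c = tri< (chr<chr a) (λ e → b (chr-inj e)) (λ { (chr<chr p) → c p })
  ... | tri≈ a b c = tri≈ (λ { (chr<chr p) → a p }) (cong chr b) (λ { (chr<chr p) → c p })
  ... | tri> a b c = tri> (λ { (chr<chr p) → a p }) (λ e → b (chr-inj e)) (chr<chr c)

  <ₛ-isStrictTotalOrder : IsStrictTotalOrder _≡_ _<ₛ_
  <ₛ-isStrictTotalOrder = record
    { isStrictPartialOrder = record
      { isEquivalence = isEquivalence
      ; irrefl        = <ₛ-irrefl
      ; trans         = <ₛ-trans
      ; <-resp-≈      = resp₂ _<ₛ_
      }
    ; compare = <ₛ-compare
    }

  open IsStrictTotalOrder (LexS.<-isStrictTotalOrder <ₛ-isStrictTotalOrder)
    using () renaming (trans to <ₗ-trans; irrefl to <ₗ-irrefl-≋; compare to <ₗ-compare-≋)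

  <ₗ-irrefl : ∀ {X} → ¬ X <ₗ X
  <ₗ-irrefl = <ₗ-irrefl-≋ (≡⇒Pointwise-≡ refl)

  ∷-<ₗ-tail : ∀ {x y : Sym A} {U V} → x ≡ y → (x ∷ U) <ₗ (y ∷ V) → U <ₗ V
  ∷-<ₗ-tail x≡y (this x<y)  = contradiction x<y (<ₛ-irrefl x≡y)
  ∷-<ₗ-tail _   (next _ U<V) = U<V

  ∈-range⁺ : ∀ {lo hi k} → lo ≤ k → k < hi → Any (k ≡_) (range lo hi)
  ∈-range⁺ {lo} {hi} {k} lo≤k k<hi =
    map⁺ (Any.map (λ k∸lo≡j → trans (sym (m+[n∸m]≡n lo≤k)) (cong (lo +_) k∸lo≡j))
                  (∈-upTo⁺ (∸-monoˡ-< k<hi lo≤k)))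

  countBelow-mono : ∀ T s {X Y} → X <ₗ Y → countBelow T s X ≤ countBelow T s Y
  countBelow-mono T s X<Y =
    length-filter-mono (λ k → suf T k <ₗ? _) (λ k → suf T k <ₗ? _)
                       (λ Tₖ<X → <ₗ-trans Tₖ<X X<Y) (range (suc s) (length T))

  countBelow-mono-< : ∀ T s {k X} → suc s ≤ k → k < length T → suf T k <ₗ X →
                      countBelow T s (suf T k) < countBelow T s X
  countBelow-mono-< T s {k} s<k k<n Tₖ<X =
    length-filter-mono-< (λ j → suf T j <ₗ? suf T k) (λ j → suf T j <ₗ? _)
      (λ Tⱼ<Tₖ → <ₗ-trans Tⱼ<Tₖ Tₖ<X) (range (suc s) (length T))
      (Any.map (λ { refl → Tₖ<X , <ₗ-irrefl }) (∈-range⁺ s<k k<n))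

  countBelow-suc⇒<ₗ : ∀ T s X Y → suc (countBelow T s X) ≡ countBelow T s Y → X <ₗ Y
  countBelow-suc⇒<ₗ T s X Y count≡ with <ₗ-compare-≋ X Y
  ... | tri< X<Y _ _ = X<Y
  ... | tri≈ _ X≋Y _ =
    contradiction (trans count≡ (cong (countBelow T s) (sym (Pointwise-≡⇒≡ X≋Y)))) 1+n≢n
  ... | tri> _ _ Y<X =
    contradiction (≤-trans (≤-reflexive count≡) (countBelow-mono T s Y<X)) 1+n≰n

  pos≡rank⇒suf<suf : ∀ T s a → pos T s a ≡ rank T s → suf T a <ₗ suf T s
  pos≡rank⇒suf<suf T s a pos≡rank =
    countBelow-suc⇒<ₗ T s _ _ (+-cancelˡ-≡ s _ _ (trans (+-suc s _) pos≡rank))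

  suf-suc-<ₗ : ∀ T {a s} → a < length T → s < length T → at T a ≡ at T s →
               suf T a <ₗ suf T s → suf T (suc a) <ₗ suf T (suc s)
  suf-suc-<ₗ T {a} {s} a<n s<n Tₐ≡Tₛ Tₐ<Tₛ
    with x , Tₐ≡x∷ ← drop-∷ T a a<n | y , Tₛ≡y∷ ← drop-∷ T s s<n =
    ∷-<ₗ-tail x≡y (subst₂ _<ₗ_ Tₐ≡x∷ Tₛ≡y∷ Tₐ<Tₛ)
    where
    x≡y : x ≡ y
    x≡y = just-injective (trans (cong head (sym Tₐ≡x∷)) (trans Tₐ≡Tₛ (cong head Tₛ≡y∷)))

lemma1 : {A : Set} {_<ₐ_ : Rel A 0ℓ} (isSTO : IsStrictTotalOrder _≡_ _<ₐ_)
         (w : List A) → 1 ≤ length w →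
         let open Suffixes isSTO
             T = text w
             n = length T
         in (s a : ℕ) → s + 3 ≤ n →
            suc s ≤ a → a ≤ n ∸ 2 →
            pos T s a ≡ rank T s →
            ¬ (suc s ≤ pos T s (suc a) × pos T s (suc a) < pos T s (suc s)) →
            at T a ≢ at T s
lemma1 {A} isSTO w _ s a s+3≤n s<a a≤n∸2 pos≡rank pₐ₊₁∉[s+1,p⟩ Tₐ≡Tₛ =
  pₐ₊₁∉[s+1,p⟩ (m≤m+n (suc s) _ , +-monoʳ-< (suc s) countₐ₊₁<countₛ₊₁)
  where
  open Suffixes isSTO
  open SuffixOrder isSTO
  T : List (Sym A)
  T = text w
  n : ℕ
  n = length T
  a+1<n : suc a < n
  a+1<n = ≤-trans (+-monoʳ-≤ 2 a≤n∸2) (≤-reflexive (m+[n∸m]≡n (<⇒≤ (m+n≤o⇒n≤o s s+3≤n))))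
  a<n : a < n
  a<n = <-trans (n<1+n a) a+1<n
  countₐ₊₁<countₛ₊₁ : countBelow T s (suf T (suc a)) < countBelow T s (suf T (suc s))
  countₐ₊₁<countₛ₊₁ =
    countBelow-mono-< T s (m≤n⇒m≤1+n s<a) a+1<n
      (suf-suc-<ₗ T a<n (<-trans s<a a<n) Tₐ≡Tₛ (pos≡rank⇒suf<suf T s a pos≡rank))
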